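{- Let $\mathcal{A}$ be a computable equivalence structure, let $C$ be a cohesive set, and let $\mathcal{B}=\prod_C\mathcal{A}$. Then: (a) $\chi(\mathcal{B})=\chi(\mathcal{A})$. (b) If $\mathcal{A}$ has infinitely many infinite equivalence classes, then $\mathcal{B}$ has infinitely many infinite equivalence classes. If $\mathcal{A}$ has exactly $n$ infinite equivalence classes, then $\mathcal{B}$ has at least $n$ infinite equivalence classes. (c) If $\mathcal{A}$ has infinitely many infinite equivalence classes, then $\prod_C\mathcal{A}\cong\mathcal{A}$. (d) If $\mathcal{A}$ has finitely many finite equivalence classes and no infinite equivalence classes, then $\prod_C\mathcal{A}\cong\mathcal{A}$.
   Context: An equivalence structure $(A,E)$ is a set with an equivalence relation; it is computable if $A\subseteq\omega$ and $E$ are computable. The character of an equivalence structure $\mathcal{A}$ is $\chi(\mathcal{A})=\{\langle k,n\rangle: n,k>0$ and $\mathcal{A}$ has at least $n$ equivalence classes of size $k\}$, where $\langle\cdot,\cdot\rangle$ is a fixed computable pairing bijection. A set $C\subseteq\omega$ is cohesive if it is infinite and for every c.e. set $W$, one of $W\cap C$, $\overline{W}\cap C$ is finite; $X\subseteq^*Y$ means $X\setminus Y$ is finite. The cohesive power $\prod_C\mathcal{A}$ has as domain the partial computable functions $\psi:\omega\to A$ with $C\subseteq^*\mathrm{dom}(\psi)$, modulo $\psi_1=_C\psi_2$ iff $C\subseteq^*\{i:\psi_1(i)\downarrow=\psi_2(i)\downarrow\}$, and $[\psi_1]E[\psi_2]$ holds in it iff $C\subseteq^*\{i:\psi_1(i)E\psi_2(i)\}$.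 -}

module Defs where

open import Level using (0ℓ)
open import Data.Nat using (ℕ; zero; suc; _≤_; _<_)
open import Data.Fin using (Fin)
open import Data.Vec using (Vec; []; _∷_; lookup)
open import Data.Product using (Σ; ∃; _×_; _,_; proj₁)
open import Data.Sum using (_⊎_)
open import Relation.Nullary using (¬_)
open import Relation.Binary.PropositionalEquality using (_≡_)

-- A model of computation: codes for μ-recursive (partial recursive)
-- functions of arity n, with an inductive big-step evaluation relation.

data Code : ℕ → Set where
  Z    : ∀ {n} → Code n
  S    : Code 1
  P    : ∀ {n} → Fin n → Code n
  comp : ∀ {n m} → Code m → Vec (Code n) m → Code n
  rec  : ∀ {n} → Code n → Code (suc (suc n)) → Code (suc n)
  mu   : ∀ {n} → Code (suc n) → Code n

mutual
  data Eval : ∀ {n} → Code n → Vec ℕ n → ℕ → Set where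
    evZ    : ∀ {n} {xs : Vec ℕ n} → Eval Z xs 0
    evS    : ∀ {x} → Eval S (x ∷ []) (suc x)
    evP    : ∀ {n} {xs : Vec ℕ n} (i : Fin n) → Eval (P i) xs (lookup xs i)
    evComp : ∀ {n m} {f : Code m} {gs : Vec (Code n) m} {xs ys z} →
             EvalAll gs xs ys → Eval f ys z → Eval (comp f gs) xs z
    evRec0 : ∀ {n} {g : Code n} {h : Code (suc (suc n))} {xs z} →
             Eval g xs z → Eval (rec g h) (0 ∷ xs) z
    evRecS : ∀ {n} {g : Code n} {h : Code (suc (suc n))} {k xs r z} →
             Eval (rec g h) (k ∷ xs) r → Eval h (k ∷ r ∷ xs) z →
             Eval (rec g h) (suc k ∷ xs) z
    evMu   : ∀ {n} {f : Code (suc n)} {xs y} →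
             Eval f (y ∷ xs) 0 →
             (∀ i → i < y → ∃ λ k → Eval f (i ∷ xs) (suc k)) →
             Eval (mu f) xs y

  data EvalAll : ∀ {n m} → Vec (Code n) m → Vec ℕ n → Vec ℕ m → Set where
    []  : ∀ {n} {xs : Vec ℕ n} → EvalAll [] xs []
    _∷_ : ∀ {n m} {g : Code n} {gs : Vec (Code n) m} {xs y ys} →
          Eval g xs y → EvalAll gs xs ys → EvalAll (g ∷ gs) xs (y ∷ ys)

_·_↦_ : Code 1 → ℕ → ℕ → Set
f · x ↦ v = Eval f (x ∷ []) v

_·_↓ : Code 1 → ℕ → Set
f · x ↓ = ∃ λ v → f · x ↦ v

ComputableSet : (ℕ → Set) → Set
ComputableSet X = Σ (Code 1) λ f →
  ∀ x → (X x → f · x ↦ 1) × (¬ X x → f · x ↦ 0)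

ComputableRel : (ℕ → ℕ → Set) → Set
ComputableRel R = Σ (Code 2) λ f →
  ∀ x y → (R x y → Eval f (x ∷ y ∷ []) 1) × (¬ R x y → Eval f (x ∷ y ∷ []) 0)

Finite : (ℕ → Set) → Set
Finite X = ∃ λ N → ∀ i → X i → i < N

Infinite : (ℕ → Set) → Set
Infinite X = ¬ Finite X

_⊆*_ : (ℕ → Set) → (ℕ → Set) → Set
X ⊆* Y = ∃ λ N → ∀ i → N ≤ i → X i → Y i

-- C is cohesive: infinite, and for every c.e. set W = dom ψ_f,
-- W ∩ C or (complement W) ∩ C is finite
Cohesive : (ℕ → Set) → Set
Cohesive C = Infinite C ×
  (∀ (f : Code 1) → Finite (λ i → f · i ↓ × C i)
                  ⊎ Finite (λ i → ¬ (f · i ↓) × C i))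

record EqStruct : Set₁ where
  field
    Dom   : ℕ → Set
    E     : ℕ → ℕ → Set
    E-dom : ∀ {x y} → E x y → Dom x × Dom y
    E-refl  : ∀ {x} → Dom x → E x x
    E-sym   : ∀ {x y} → E x y → E y x
    E-trans : ∀ {x y z} → E x y → E y z → E x z

ComputableEqStruct : EqStruct → Set
ComputableEqStruct 𝒜 = ComputableSet (EqStruct.Dom 𝒜) × ComputableRel (EqStruct.E 𝒜)

-- Abstract structures: a carrier with an equality (≈) and a binary
-- relation R; used to speak uniformly about 𝒜 and its cohesive power.

record Str : Set₁ where
  field
    Carrier : Set
    _≈_     : Carrier → Carrier → Set
    R       : Carrier → Carrier → Set

infix 2 _⇔_
_⇔_ : Set → Set → Set
X ⇔ Y = (X → Y) × (Y → X)

module _ (𝒮 : Str) where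
  open Str 𝒮

  ClassSize : ℕ → Carrier → Set
  ClassSize k x = Σ (Fin k → Carrier) λ g →
    (∀ i → R (g i) x) × (∀ i j → g i ≈ g j → i ≡ j) ×
    (∀ y → R y x → ∃ λ i → y ≈ g i)

  FiniteClass : Carrier → Set
  FiniteClass x = ∃ λ k → ClassSize k x

  InfiniteClass : Carrier → Set
  InfiniteClass x = ∀ m → Σ (Fin m → Carrier) λ g →
    (∀ i → R (g i) x) × (∀ i j → g i ≈ g j → i ≡ j)

  AtLeastClasses : (Carrier → Set) → ℕ → Set
  AtLeastClasses Q n = Σ (Fin n → Carrier) λ g →
    (∀ i → Q (g i)) × (∀ i j → R (g i) (g j) → i ≡ j)

  χ : ℕ → ℕ → Set
  χ k n = 0 < k × 0 < n × AtLeastClasses (ClassSize k) n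

  InfinitelyManyInfiniteClasses : Set
  InfinitelyManyInfiniteClasses = ∀ n → AtLeastClasses InfiniteClass n

  ExactlyInfiniteClasses : ℕ → Set
  ExactlyInfiniteClasses n =
    AtLeastClasses InfiniteClass n × ¬ AtLeastClasses InfiniteClass (suc n)

  FinitelyManyFiniteClasses : Set
  FinitelyManyFiniteClasses = ∃ λ m → ¬ AtLeastClasses FiniteClass (suc m)

  NoInfiniteClasses : Set
  NoInfiniteClasses = ∀ x → ¬ InfiniteClass x

_≅_ : Str → Str → Set
𝒮 ≅ 𝒯 = Σ (S.Carrier → T.Carrier) λ h →
    (∀ x y → x S.≈ y ⇔ h x T.≈ h y) ×
    (∀ y → ∃ λ x → h x T.≈ y) ×
    (∀ x y → S.R x y ⇔ T.R (h x) (h y))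
  where
    module S = Str 𝒮
    module T = Str 𝒯

asStr : EqStruct → Str
asStr 𝒜 = record
  { Carrier = Σ ℕ Dom
  ; _≈_ = λ a b → proj₁ a ≡ proj₁ b
  ; R = λ a b → E (proj₁ a) (proj₁ b) }
  where open EqStruct 𝒜

module _ (𝒜 : EqStruct) (C : ℕ → Set) where
  open EqStruct 𝒜

  PowerElem : Code 1 → Set
  PowerElem ψ = (∀ i v → ψ · i ↦ v → Dom v) × (C ⊆* (λ i → ψ · i ↓))

  _=C_ : Code 1 → Code 1 → Set
  ψ₁ =C ψ₂ = C ⊆* (λ i → ∃ λ v → ψ₁ · i ↦ v × ψ₂ · i ↦ v)

  _EC_ : Code 1 → Code 1 → Set
  ψ₁ EC ψ₂ = C ⊆* (λ i → ∃ λ u → ∃ λ v → ψ₁ · i ↦ u × ψ₂ · i ↦ v × E u v)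

  CohesivePower : Str
  CohesivePower = record
    { Carrier = Σ (Code 1) PowerElem
    ; _≈_ = λ a b → proj₁ a =C proj₁ b
    ; R = λ a b → proj₁ a EC proj₁ b }

module Submission where

-- The constant functions embed 𝒜 into ℬ, preserving and reflecting equality and E and
-- preserving the size of every class; so χ(𝒜) ⊆ χ(ℬ), and infinite classes stay infinite.
-- Conversely, the set of coordinates on which two partial computable functions agree (or have
-- E-equivalent values) is c.e., so by cohesiveness finitely many pairwise distinct (or pairwise
-- inequivalent) elements of ℬ stay so at almost every coordinate in C. If the class of ψ in ℬ has
-- k elements, the search for a further element in the class of ψ(i) must diverge on almost all
-- of C (otherwise it would define a new member of the class of ψ), so the class of ψ(i) has
-- exactly k elements there; hence χ(ℬ) = χ(𝒜). Likewise, if the classes of 𝒜 have bounded size,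
-- so do those of ℬ. Finally ℬ is countable, its elements being indexed by codes, and two
-- countable equivalence structures with equally many classes of each size, and equally many
-- infinite classes, are isomorphic by a back-and-forth construction.

open import Defs
open import Level using (0ℓ)
open import Axiom.ExcludedMiddle using (ExcludedMiddle)
open import Data.Nat using (ℕ; zero; suc; pred; _+_; _∸_; _≤_; _<_; z≤n; s≤s; _⊔_)
open import Data.Nat.Properties
open import Data.Nat.Binary.Base using (ℕᵇ; 2[1+_]; 1+[2_]) renaming (zero to 0ᵇ; toℕ to ℕᵇ⇒ℕ)
open import Data.Nat.Binary.Properties using (2[1+_]-injective) renaming (toℕ-injective to ℕᵇ⇒ℕ-injective)
open import Data.Fin using (Fin; zero; suc; toℕ) renaming (_≟_ to _≟ᶠ_)
open import Data.Fin.Properties using (injective⇒≤; toℕ-injective)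
open import Data.Vec using (Vec; []; _∷_)
open import Data.Vec.Functional using (Vector) renaming (_∷_ to _∷ᶠ_)
open import Data.Maybe using (Maybe; just; nothing)
open import Data.Product using (Σ; ∃; ∃₂; _×_; _,_; proj₁; proj₂; swap)
open import Data.Sum using (_⊎_; inj₁; inj₂)
open import Data.Empty using (⊥; ⊥-elim)
open import Relation.Nullary using (¬_; Dec; yes; no; decidable-stable)
open import Relation.Binary.Definitions using (Symmetric; Transitive; tri<; tri≈; tri>)
open import Relation.Binary.PropositionalEquality

-- Partial recursive functions

mutual
  eval-deterministic : ∀ {n} {f : Code n} {xs v w} → Eval f xs v → Eval f xs w → v ≡ w
  eval-deterministic evZ evZ = refl
  eval-deterministic evS evS = refl
  eval-deterministic (evP i) (evP .i) = refl
  eval-deterministic (evComp es e) (evComp es′ e′)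
    with refl ← evalAll-deterministic es es′ = eval-deterministic e e′
  eval-deterministic (evRec0 e) (evRec0 e′) = eval-deterministic e e′
  eval-deterministic (evRecS r e) (evRecS r′ e′)
    with refl ← eval-deterministic r r′ = eval-deterministic e e′
  eval-deterministic (evMu {y = y} e₀ below) (evMu {y = y′} e₀′ below′) with <-cmp y y′
  ... | tri< y<y′ _ _ = ⊥-elim (0≢1+n (eval-deterministic e₀ (proj₂ (below′ y y<y′))))
  ... | tri≈ _ refl _ = refl
  ... | tri> _ _ y′<y = ⊥-elim (0≢1+n (eval-deterministic e₀′ (proj₂ (below y′ y′<y))))

  evalAll-deterministic : ∀ {n m} {gs : Vec (Code n) m} {xs ys zs} →
    EvalAll gs xs ys → EvalAll gs xs zs → ys ≡ zs
  evalAll-deterministic [] [] = refl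
  evalAll-deterministic (e ∷ es) (e′ ∷ es′) =
    cong₂ _∷_ (eval-deterministic e e′) (evalAll-deterministic es es′)

Eval₂ : Code 2 → ℕ → ℕ → ℕ → Set
Eval₂ G u v z = Eval G (u ∷ v ∷ []) z

eval-comp₁ : ∀ {n} {h : Code 1} {F : Code n} {xs u z} →
  Eval F xs u → h · u ↦ z → Eval (comp h (F ∷ [])) xs z
eval-comp₁ eF eh = evComp (eF ∷ []) eh

comp₁-inversion : ∀ {n} {h : Code 1} {F : Code n} {xs z} →
  Eval (comp h (F ∷ [])) xs z → ∃ λ u → Eval F xs u × h · u ↦ z
comp₁-inversion (evComp (eF ∷ []) eh) = _ , eF , eh

eval-comp₂ : ∀ {n} {h : Code 2} {F G : Code n} {xs u v z} →
  Eval F xs u → Eval G xs v → Eval₂ h u v z → Eval (comp h (F ∷ G ∷ [])) xs z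
eval-comp₂ eF eG eh = evComp (eF ∷ eG ∷ []) eh

comp₂-inversion : ∀ {n} {h : Code 2} {F G : Code n} {xs z} →
  Eval (comp h (F ∷ G ∷ [])) xs z → ∃₂ λ u v → Eval F xs u × Eval G xs v × Eval₂ h u v z
comp₂-inversion (evComp (eF ∷ eG ∷ []) eh) = _ , _ , eF , eG , eh

predᶜ : Code 1
predᶜ = rec Z (P zero)

eval-pred : ∀ k → predᶜ · k ↦ pred k
eval-pred zero = evRec0 evZ
eval-pred (suc k) = evRecS (eval-pred k) (evP zero)

-- Primitive recursion runs on the first argument, so monusᶜ on (k , x) computes x ∸ k.
monusᶜ : Code 2
monusᶜ = rec (P zero) (comp predᶜ (P (suc zero) ∷ []))

eval-monus : ∀ k x → Eval₂ monusᶜ k x (x ∸ k)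
eval-monus zero x = evRec0 (evP zero)
eval-monus (suc k) x = subst (Eval₂ monusᶜ (suc k) x) (pred[m∸n]≡m∸[1+n] x k)
  (evRecS (eval-monus k x) (eval-comp₁ (evP (suc zero)) (eval-pred (x ∸ k))))

addᶜ : Code 2
addᶜ = rec (P zero) (comp S (P (suc zero) ∷ []))

eval-add : ∀ k x → Eval₂ addᶜ k x (k + x)
eval-add zero x = evRec0 (evP zero)
eval-add (suc k) x = evRecS (eval-add k x) (eval-comp₁ (evP (suc zero)) evS)

isZero : ℕ → ℕ
isZero zero = 1
isZero (suc _) = 0

isZeroᶜ : Code 1
isZeroᶜ = rec (comp S (Z ∷ [])) Z

eval-isZero : ∀ k → isZeroᶜ · k ↦ isZero k
eval-isZero zero = evRec0 (eval-comp₁ evZ evS)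
eval-isZero (suc k) = evRecS (eval-isZero k) evZ

constᶜ : ∀ {n} → ℕ → Code n
constᶜ zero = Z
constᶜ (suc a) = comp S (constᶜ a ∷ [])

eval-const : ∀ {n} {xs : Vec ℕ n} a → Eval (constᶜ a) xs a
eval-const zero = evZ
eval-const (suc a) = eval-comp₁ (eval-const a) evS

-- G decides Φ, answering 0 for yes.
record ZeroTest (G : Code 2) (Φ : ℕ → ℕ → Set) : Set where
  field
    total : ∀ u v → ∃ (Eval₂ G u v)
    zero⇒ : ∀ {u v} → Eval₂ G u v 0 → Φ u v
    ⇒zero : ∀ {u v} → Φ u v → Eval₂ G u v 0

ZeroTest-map : ∀ {G Φ Ψ} → (∀ {u v} → Φ u v → Ψ u v) → (∀ {u v} → Ψ u v → Φ u v) →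
  ZeroTest G Φ → ZeroTest G Ψ
ZeroTest-map Φ⇒Ψ Ψ⇒Φ T = record
  { total = total ; zero⇒ = λ e → Φ⇒Ψ (zero⇒ e) ; ⇒zero = λ q → ⇒zero (Ψ⇒Φ q) }
  where open ZeroTest T

ZeroTest-¬ : ∀ {G Φ} → ZeroTest G Φ → ZeroTest (comp isZeroᶜ (G ∷ [])) (λ u v → ¬ Φ u v)
ZeroTest-¬ {G} {Φ} T = record { total = total′ ; zero⇒ = zero⇒′ ; ⇒zero = ⇒zero′ }
  where
  open ZeroTest T
  total′ : ∀ u v → ∃ (Eval₂ (comp isZeroᶜ (G ∷ [])) u v)
  total′ u v with w , e ← total u v = isZero w , eval-comp₁ e (eval-isZero w)
  zero⇒′ : ∀ {u v} → Eval₂ (comp isZeroᶜ (G ∷ [])) u v 0 → ¬ Φ u v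
  zero⇒′ e p with _ , e₁ , e₂ ← comp₁-inversion e
    with refl ← eval-deterministic (⇒zero p) e₁ = 0≢1+n (eval-deterministic e₂ (eval-isZero 0))
  ⇒zero′ : ∀ {u v} → ¬ Φ u v → Eval₂ (comp isZeroᶜ (G ∷ [])) u v 0
  ⇒zero′ {u} {v} ¬p with total u v
  ... | zero , e = ⊥-elim (¬p (zero⇒ e))
  ... | suc w , e = eval-comp₁ e (eval-isZero (suc w))

distᶜ : Code 2
distᶜ = comp addᶜ (monusᶜ ∷ comp monusᶜ (P (suc zero) ∷ P zero ∷ []) ∷ [])

eval-dist : ∀ u v → Eval₂ distᶜ u v ((v ∸ u) + (u ∸ v))
eval-dist u v = eval-comp₂ (eval-monus u v)
  (eval-comp₂ (evP (suc zero)) (evP zero) (eval-monus v u)) (eval-add (v ∸ u) (u ∸ v))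

distᶜ-zeroTest : ZeroTest distᶜ _≡_
distᶜ-zeroTest = record
  { total = λ u v → _ , eval-dist u v
  ; zero⇒ = λ {u} {v} e → dist≡0⇒≡ (eval-deterministic (eval-dist u v) e)
  ; ⇒zero = λ { {u} refl → subst (Eval₂ distᶜ u u) (cong₂ _+_ (n∸n≡0 u) (n∸n≡0 u)) (eval-dist u u) } }
  where
  dist≡0⇒≡ : ∀ {u v} → (v ∸ u) + (u ∸ v) ≡ 0 → u ≡ v
  dist≡0⇒≡ {u} {v} eq =
    ≤-antisym (m∸n≡0⇒m≤n (m+n≡0⇒n≡0 (v ∸ u) eq)) (m∸n≡0⇒m≤n (m+n≡0⇒m≡0 (v ∸ u) eq))

neqᶜ : Code 2
neqᶜ = comp isZeroᶜ (distᶜ ∷ [])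

neqᶜ-zeroTest : ZeroTest neqᶜ (λ u v → u ≢ v)
neqᶜ-zeroTest = ZeroTest-¬ distᶜ-zeroTest

at : Code 1 → Code 2
at ψ = comp ψ (P (suc zero) ∷ [])

eval-at : ∀ {ψ y i v} → ψ · i ↦ v → Eval₂ (at ψ) y i v
eval-at e = eval-comp₁ (evP (suc zero)) e

at-inversion : ∀ {ψ y i v} → Eval₂ (at ψ) y i v → ψ · i ↦ v
at-inversion (evComp (evP _ ∷ []) e) = e

against : Code 2 → Code 1 → Code 2
against T ψ = comp T (P zero ∷ at ψ ∷ [])

eval-against : ∀ {T ψ y i u z} → ψ · i ↦ u → Eval₂ T y u z → Eval₂ (against T ψ) y i z
eval-against eu eT = eval-comp₂ (evP zero) (eval-at eu) eT

against-inversion : ∀ {T ψ y i z} → Eval₂ (against T ψ) y i z → ∃ λ u → ψ · i ↦ u × Eval₂ T y u z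
against-inversion e with _ , u , evP zero , eu , eT ← comp₂-inversion e = u , at-inversion eu , eT

zeroSetᶜ : Code 2 → Code 1 → Code 1 → Code 1
zeroSetᶜ G ψ φ = mu (comp G (at ψ ∷ at φ ∷ []))

zeroSet-halts⇒ : ∀ {G Φ ψ φ i} → ZeroTest G Φ → zeroSetᶜ G ψ φ · i ↓ →
  ∃₂ λ u v → ψ · i ↦ u × φ · i ↦ v × Φ u v
zeroSet-halts⇒ T (_ , evMu e _) with u , v , eu , ev , eG ← comp₂-inversion e =
  u , v , at-inversion eu , at-inversion ev , ZeroTest.zero⇒ T eG

⇒zeroSet-halts : ∀ {G Φ ψ φ i u v} → ZeroTest G Φ → ψ · i ↦ u → φ · i ↦ v → Φ u v →
  zeroSetᶜ G ψ φ · i ↓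
⇒zeroSet-halts T eu ev p =
  0 , evMu (eval-comp₂ (eval-at eu) (eval-at ev) (ZeroTest.⇒zero T p)) (λ _ ())

mu-halts : ∀ {n} {F : Code (suc n)} {xs} → (∀ y → ∃ λ v → Eval F (y ∷ xs) v) →
  ∀ y₀ → Eval F (y₀ ∷ xs) 0 → ∃ (Eval (mu F) xs)
mu-halts {n} {F} {xs} total y₀ e₀ = search y₀ 0 refl (λ _ ())
  where
  search : ∀ fuel y → y + fuel ≡ y₀ → (∀ i → i < y → ∃ λ k → Eval F (i ∷ xs) (suc k)) →
    ∃ (Eval (mu F) xs)
  search fuel y y+fuel≡y₀ below with total y
  ... | zero , e = y , evMu e below
  search zero y y+0≡y₀ below | suc k , e
    with refl ← trans (sym (+-identityʳ y)) y+0≡y₀ = ⊥-elim (0≢1+n (eval-deterministic e₀ e))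
  search (suc fuel) y y+fuel≡y₀ below | suc k , e =
    search fuel (suc y) (trans (sym (+-suc y fuel)) y+fuel≡y₀) below′
    where
    below′ : ∀ i → i < suc y → ∃ λ k → Eval F (i ∷ xs) (suc k)
    below′ i i<1+y with m<1+n⇒m<n∨m≡n i<1+y
    ... | inj₁ i<y = below i i<y
    ... | inj₂ refl = k , e

sumᶜ : ∀ {n} k → (Fin k → Code n) → Code n
sumᶜ zero G = Z
sumᶜ (suc k) G = comp addᶜ (G zero ∷ sumᶜ k (λ j → G (suc j)) ∷ [])

sumᶜ-total : ∀ {n} k (G : Fin k → Code n) {xs} →
  (∀ j → ∃ (Eval (G j) xs)) → ∃ (Eval (sumᶜ k G) xs)
sumᶜ-total zero G total = 0 , evZ
sumᶜ-total (suc k) G total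
  with u , eu ← total zero | v , ev ← sumᶜ-total k (λ j → G (suc j)) (λ j → total (suc j)) =
  u + v , eval-comp₂ eu ev (eval-add u v)

sumᶜ-zero⇒ : ∀ {n} k (G : Fin k → Code n) {xs} → Eval (sumᶜ k G) xs 0 → ∀ j → Eval (G j) xs 0
sumᶜ-zero⇒ (suc k) G e j with u , v , eu , ev , eh ← comp₂-inversion e
  with u+v≡0 ← eval-deterministic (eval-add u v) eh | j
... | zero = subst (Eval (G zero) _) (m+n≡0⇒m≡0 u u+v≡0) eu
... | suc j′ = sumᶜ-zero⇒ k (λ j → G (suc j)) (subst (Eval (sumᶜ k _) _) (m+n≡0⇒n≡0 u u+v≡0) ev) j′

⇒sumᶜ-zero : ∀ {n} k (G : Fin k → Code n) {xs} → (∀ j → Eval (G j) xs 0) → Eval (sumᶜ k G) xs 0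
⇒sumᶜ-zero zero G zeros = evZ
⇒sumᶜ-zero (suc k) G zeros =
  eval-comp₂ (zeros zero) (⇒sumᶜ-zero k (λ j → G (suc j)) (λ j → zeros (suc j))) (eval-add 0 0)

-- Almost inclusion and cohesive sets

module _ {C : ℕ → Set} where

  ⊆*-mono : ∀ {P Q : ℕ → Set} → (∀ {i} → C i → P i → Q i) → C ⊆* P → C ⊆* Q
  ⊆*-mono P⇒Q (N , C⊆P) = N , λ i N≤i ci → P⇒Q ci (C⊆P i N≤i ci)

  ⊆*-× : ∀ {P Q : ℕ → Set} → C ⊆* P → C ⊆* Q → C ⊆* (λ i → P i × Q i)
  ⊆*-× (N , C⊆P) (M , C⊆Q) = N ⊔ M , λ i N⊔M≤i ci →
    C⊆P i (m⊔n≤o⇒m≤o N M N⊔M≤i) ci , C⊆Q i (m⊔n≤o⇒n≤o N M N⊔M≤i) ci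

  ⊆*-universal : ∀ {P : ℕ → Set} → (∀ i → P i) → C ⊆* P
  ⊆*-universal P-all = 0 , λ i _ _ → P-all i

  ⊆*-Π : ∀ {k} {P : Fin k → ℕ → Set} → (∀ j → C ⊆* P j) → C ⊆* (λ i → ∀ j → P j i)
  ⊆*-Π {zero} _ = ⊆*-universal λ _ ()
  ⊆*-Π {suc k} C⊆P = ⊆*-mono (λ { _ (p₀ , ps) → λ { zero → p₀ ; (suc j) → ps j } })
    (⊆*-× (C⊆P zero) (⊆*-Π (λ j → C⊆P (suc j))))

module _ (em : ExcludedMiddle 0ℓ) {C : ℕ → Set} where

  Infinite⇒unbounded : Infinite C → ∀ N → ∃ λ i → N ≤ i × C i
  Infinite⇒unbounded C-inf N with em {∃ λ i → N ≤ i × C i}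
  ... | yes found = found
  ... | no none = ⊥-elim (C-inf (N , below))
    where
    below : ∀ i → C i → i < N
    below i ci with N ≤? i
    ... | yes N≤i = ⊥-elim (none (i , N≤i , ci))
    ... | no N≰i = ≰⇒> N≰i

  ⊆*-witness : ∀ {P : ℕ → Set} → Infinite C → C ⊆* P → ∃ λ i → C i × P i
  ⊆*-witness C-inf (N , C⊆P) with i , N≤i , ci ← Infinite⇒unbounded C-inf N = i , ci , C⊆P i N≤i ci

  cohesive-dichotomy : Cohesive C → ∀ f → C ⊆* (f ·_↓) ⊎ C ⊆* (λ i → ¬ f · i ↓)
  cohesive-dichotomy (_ , split) f with split f
  ... | inj₁ (N , bound) = inj₂ (N , λ i N≤i ci halts → <⇒≱ (bound i (halts , ci)) N≤i)
  ... | inj₂ (N , bound) = inj₁ (N , halts)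
    where
    halts : ∀ i → N ≤ i → C i → f · i ↓
    halts i N≤i ci with em {f · i ↓}
    ... | yes h = h
    ... | no ¬h = ⊥-elim (<⇒≱ (bound i (¬h , ci)) N≤i)

-- Finite families

Separated : ∀ {A : Set} → (A → A → Set) → ∀ {n} → Vector A n → Set
Separated _~_ f = ∀ i j → f i ~ f j → i ≡ j

∷-separated : ∀ {A : Set} {_~_ : A → A → Set} → Symmetric _~_ → ∀ {n x} {f : Vector A n} →
  (∀ j → ¬ x ~ f j) → Separated _~_ f → Separated _~_ (x ∷ᶠ f)
∷-separated sym′ new sep zero zero _ = refl
∷-separated sym′ new sep zero (suc j) x~fj = ⊥-elim (new j x~fj)
∷-separated sym′ new sep (suc i) zero fi~x = ⊥-elim (new i (sym′ fi~x))
∷-separated sym′ new sep (suc i) (suc j) fi~fj = cong suc (sep i j fi~fj)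

∷-all : ∀ {A : Set} {P : A → Set} {n x} {f : Vector A n} → P x → (∀ j → P (f j)) → ∀ j → P ((x ∷ᶠ f) j)
∷-all px pf zero = px
∷-all px pf (suc j) = pf j

separated-cover⇒≤ : ∀ {A : Set} {_~_ : A → A → Set} → Symmetric _~_ → Transitive _~_ →
  ∀ {m n} {f : Vector A m} (g : Vector A n) → Separated _~_ f → (∀ i → ∃ λ j → f i ~ g j) → m ≤ n
separated-cover⇒≤ {_~_ = _~_} sym′ trans′ g sep cover = injective⇒≤ λ {i} {i′} same →
  sep i i′ (trans′ (proj₂ (cover i)) (subst (λ j → g j ~ _) (sym same) (sym′ (proj₂ (cover i′)))))

-- The cohesive power

module PowerLaws (𝒜 : EqStruct) (C : ℕ → Set) where
  open EqStruct 𝒜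

  infix 4 _≈ᶜ_ _Eᶜ_
  _≈ᶜ_ _Eᶜ_ : Code 1 → Code 1 → Set
  _≈ᶜ_ = _=C_ 𝒜 C
  _Eᶜ_ = _EC_ 𝒜 C

  Element : Set
  Element = Σ (Code 1) (PowerElem 𝒜 C)

  ≈ᶜ-refl : ∀ {ψ} → PowerElem 𝒜 C ψ → ψ ≈ᶜ ψ
  ≈ᶜ-refl (_ , defined) = ⊆*-mono (λ { _ (v , e) → v , e , e }) defined

  ≈ᶜ-sym : ∀ {ψ φ} → ψ ≈ᶜ φ → φ ≈ᶜ ψ
  ≈ᶜ-sym = ⊆*-mono λ { _ (v , e₁ , e₂) → v , e₂ , e₁ }

  ≈ᶜ-trans : ∀ {ψ φ θ} → ψ ≈ᶜ φ → φ ≈ᶜ θ → ψ ≈ᶜ θ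
  ≈ᶜ-trans ψ≈φ φ≈θ = ⊆*-mono (λ { _ ((v , e₁ , e₂) , (w , e₃ , e₄)) →
    v , e₁ , subst (_ · _ ↦_) (eval-deterministic e₃ e₂) e₄ }) (⊆*-× ψ≈φ φ≈θ)

  Eᶜ-refl : ∀ {ψ} → PowerElem 𝒜 C ψ → ψ Eᶜ ψ
  Eᶜ-refl (in-A , defined) = ⊆*-mono (λ { _ (v , e) → v , v , e , e , E-refl (in-A _ v e) }) defined

  Eᶜ-sym : ∀ {ψ φ} → ψ Eᶜ φ → φ Eᶜ ψ
  Eᶜ-sym = ⊆*-mono λ { _ (u , v , e₁ , e₂ , Euv) → v , u , e₂ , e₁ , E-sym Euv }

  Eᶜ-trans : ∀ {ψ φ θ} → ψ Eᶜ φ → φ Eᶜ θ → ψ Eᶜ θ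
  Eᶜ-trans ψEφ φEθ = ⊆*-mono (λ { _ ((u , v , e₁ , e₂ , Euv) , (v′ , w , e₃ , e₄ , Ev′w)) →
    u , w , e₁ , e₄ , E-trans Euv (subst (λ x → E x w) (eval-deterministic e₃ e₂) Ev′w) })
    (⊆*-× ψEφ φEθ)

  ≈ᶜ⇒Eᶜ : ∀ {ψ φ} → PowerElem 𝒜 C ψ → ψ ≈ᶜ φ → ψ Eᶜ φ
  ≈ᶜ⇒Eᶜ (in-A , _) = ⊆*-mono λ { _ (v , e₁ , e₂) → v , v , e₁ , e₂ , E-refl (in-A _ v e₁) }

  Eᶜ⇒E-ae : ∀ {ψ φ} → ψ Eᶜ φ → C ⊆* (λ i → ∀ {u v} → ψ · i ↦ u → φ · i ↦ v → E u v)
  Eᶜ⇒E-ae = ⊆*-mono λ { _ (u′ , v′ , eu′ , ev′ , Eu′v′) eu ev →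
    subst₂ E (eval-deterministic eu′ eu) (eval-deterministic ev′ ev) Eu′v′ }

  values-ae : ∀ {m} (g : Vector Element m) →
    C ⊆* (λ i → Σ (Vector ℕ m) λ w → ∀ j → proj₁ (g j) · i ↦ w j)
  values-ae g = ⊆*-mono (λ _ halts → (λ j → proj₁ (halts j)) , (λ j → proj₂ (halts j)))
    (⊆*-Π λ j → proj₂ (proj₂ (g j)))

  constᴮ : Σ ℕ Dom → Element
  constᴮ (a , a∈A) = constᶜ a ,
    (λ _ _ e → subst Dom (eval-deterministic (eval-const a) e) a∈A) ,
    ⊆*-universal (λ _ → a , eval-const a)

  const-Eᶜ : ∀ {a b} → E a b → constᶜ a Eᶜ constᶜ b
  const-Eᶜ {a} {b} Eab = ⊆*-universal λ _ → a , b , eval-const a , eval-const b , Eab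

  module _ (em : ExcludedMiddle 0ℓ) (C-infinite : Infinite C) where

    const-≈ᶜ-reflects : ∀ {a b} → constᶜ a ≈ᶜ constᶜ b → a ≡ b
    const-≈ᶜ-reflects {a} {b} a≈b with _ , _ , v , e₁ , e₂ ← ⊆*-witness em C-infinite a≈b =
      trans (eval-deterministic (eval-const a) e₁) (eval-deterministic e₂ (eval-const b))

    const-Eᶜ-reflects : ∀ {a b} → constᶜ a Eᶜ constᶜ b → E a b
    const-Eᶜ-reflects {a} {b} aEb with _ , _ , u , v , e₁ , e₂ , Euv ← ⊆*-witness em C-infinite aEb =
      subst₂ E (eval-deterministic e₁ (eval-const a)) (eval-deterministic e₂ (eval-const b)) Euv

module ComputablePower (em : ExcludedMiddle 0ℓ) (𝒜 : EqStruct)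
  (E-computable : ComputableRel (EqStruct.E 𝒜))
  (C : ℕ → Set) (C-cohesive : Cohesive C) where
  open EqStruct 𝒜
  open PowerLaws 𝒜 C

  private
    C-infinite : Infinite C
    C-infinite = proj₁ C-cohesive

  ℬ 𝒜′ : Str
  ℬ = CohesivePower 𝒜 C
  𝒜′ = asStr 𝒜

  χᴱ : Code 2
  χᴱ = proj₁ E-computable

  χᴱ-zeroTest : ZeroTest χᴱ (λ u v → ¬ E u v)
  χᴱ-zeroTest = record { total = total ; zero⇒ = zero⇒ ; ⇒zero = proj₂ (proj₂ E-computable _ _) }
    where
    total : ∀ u v → ∃ (Eval₂ χᴱ u v)
    total u v with em {E u v}
    ... | yes Euv = 1 , proj₁ (proj₂ E-computable u v) Euv
    ... | no ¬Euv = 0 , proj₂ (proj₂ E-computable u v) ¬Euv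
    zero⇒ : ∀ {u v} → Eval₂ χᴱ u v 0 → ¬ E u v
    zero⇒ {u} {v} e Euv = 0≢1+n (eval-deterministic e (proj₁ (proj₂ E-computable u v) Euv))

  sameClassᶜ : Code 2
  sameClassᶜ = comp isZeroᶜ (χᴱ ∷ [])

  sameClassᶜ-zeroTest : ZeroTest sameClassᶜ E
  sameClassᶜ-zeroTest =
    ZeroTest-map (decidable-stable em) (λ Euv ¬Euv → ¬Euv Euv) (ZeroTest-¬ χᴱ-zeroTest)

  Apart : (ℕ → ℕ → Set) → Code 1 → Code 1 → ℕ → Set
  Apart Φ ψ φ i = ∀ {u v} → ψ · i ↦ u → φ · i ↦ v → ¬ Φ u v

  Meet : (ℕ → ℕ → Set) → Code 1 → Code 1 → ℕ → Set
  Meet Φ ψ φ i = ∃₂ λ u v → ψ · i ↦ u × φ · i ↦ v × Φ u v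

  -- Cohesiveness applied to the c.e. set on which G tests 0 at (ψ i , φ i).
  meet⊎apart : ∀ {G Φ} → ZeroTest G Φ → ∀ ψ φ → C ⊆* Meet Φ ψ φ ⊎ C ⊆* Apart Φ ψ φ
  meet⊎apart {G} T ψ φ with cohesive-dichotomy em C-cohesive (zeroSetᶜ G ψ φ)
  ... | inj₁ halts = inj₁ (⊆*-mono (λ _ → zeroSet-halts⇒ T) halts)
  ... | inj₂ diverges =
    inj₂ (⊆*-mono (λ _ ¬halts {_} {_} eu ev Φuv → ¬halts (⇒zeroSet-halts T eu ev Φuv)) diverges)

  ≉ᶜ⇒apart : ∀ {ψ φ} → ¬ ψ ≈ᶜ φ → C ⊆* Apart _≡_ ψ φ
  ≉ᶜ⇒apart {ψ} {φ} ψ≉φ with meet⊎apart distᶜ-zeroTest ψ φ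
  ... | inj₁ meet = ⊥-elim (ψ≉φ (⊆*-mono (λ { _ (u , _ , eu , ev , refl) → u , eu , ev }) meet))
  ... | inj₂ apart = apart

  ¬Eᶜ⇒apart : ∀ {ψ φ} → ¬ ψ Eᶜ φ → C ⊆* Apart E ψ φ
  ¬Eᶜ⇒apart {ψ} {φ} ¬ψEφ with meet⊎apart sameClassᶜ-zeroTest ψ φ
  ... | inj₁ meet = ⊥-elim (¬ψEφ meet)
  ... | inj₂ apart = apart

  separated-ae : ∀ {Φ} {_~_ : Code 1 → Code 1 → Set} →
    (∀ {ψ φ} → ¬ ψ ~ φ → C ⊆* Apart Φ ψ φ) → ∀ {m} {g : Vector (Code 1) m} → Separated _~_ g →
    C ⊆* (λ i → ∀ {w} → (∀ j → g j · i ↦ w j) → Separated Φ w)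
  separated-ae {Φ} apart {g = g} sep = ⊆*-mono separate (⊆*-Π λ j → ⊆*-Π λ j′ → equal⊎apart j j′)
    where
    equal⊎apart : ∀ j j′ → C ⊆* (λ i → j ≡ j′ ⊎ Apart Φ (g j) (g j′) i)
    equal⊎apart j j′ with j ≟ᶠ j′
    ... | yes j≡j′ = ⊆*-universal λ _ → inj₁ j≡j′
    ... | no j≢j′ = ⊆*-mono (λ _ → inj₂) (apart (λ gj~gj′ → j≢j′ (sep j j′ gj~gj′)))
    separate : ∀ {i} → C i → (∀ j j′ → j ≡ j′ ⊎ Apart Φ (g j) (g j′) i) →
      ∀ {w} → (∀ j → g j · i ↦ w j) → Separated Φ w
    separate _ dichotomy ew j j′ Φw with dichotomy j j′
    ... | inj₁ j≡j′ = j≡j′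
    ... | inj₂ apart′ = ⊥-elim (apart′ (ew j) (ew j′) Φw)

  record Snapshot {m} (ψ : Code 1) (g : Vector (Code 1) m) (i : ℕ) : Set where
    field
      centre : ℕ
      eval-centre : ψ · i ↦ centre
      members : Vector ℕ m
      eval-members : ∀ j → g j · i ↦ members j
      members-E : ∀ j → E (members j) centre
      members-separated : Separated _≡_ members

    membersᴬ : Vector (Σ ℕ Dom) m
    membersᴬ j = members j , proj₁ (E-dom (members-E j))

  snapshot-ae : ∀ {m} (ψ : Element) (g : Vector Element m) → (∀ j → proj₁ (g j) Eᶜ proj₁ ψ) →
    Separated _≈ᶜ_ (λ j → proj₁ (g j)) → C ⊆* Snapshot (proj₁ ψ) (λ j → proj₁ (g j))
  snapshot-ae (_ , _ , ψ-defined) g gEψ g-sep = ⊆*-mono snapshot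
    (⊆*-× ψ-defined (⊆*-× (values-ae g)
      (⊆*-× (⊆*-Π λ j → Eᶜ⇒E-ae (gEψ j)) (separated-ae ≉ᶜ⇒apart g-sep))))
    where
    snapshot : ∀ {i} → C i → _ → Snapshot _ _ i
    snapshot _ ((u , eu) , (w , ew) , E-at , sep-at) = record
      { centre = u ; eval-centre = eu ; members = w ; eval-members = ew
      ; members-E = λ j → E-at j (ew j) eu ; members-separated = sep-at ew }

  newMemberᶜ : ∀ {k} → Code 1 → Vector (Code 1) k → Code 1
  newMemberᶜ {k} ψ g =
    mu (comp addᶜ (against sameClassᶜ ψ ∷ sumᶜ k (λ j → against neqᶜ (g j)) ∷ []))

  newMember-sound : ∀ {k ψ} {g : Vector (Code 1) k} {i y} → newMemberᶜ ψ g · i ↦ y →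
    ∃ λ u → ψ · i ↦ u × E y u × ∀ j → ∃ λ w → g j · i ↦ w × y ≢ w
  newMember-sound {k} (evMu e _) with a , b , ea , eb , e+ ← comp₂-inversion e
    with a+b≡0 ← eval-deterministic (eval-add a b) e+
    with refl ← m+n≡0⇒m≡0 a a+b≡0 | refl ← m+n≡0⇒n≡0 a a+b≡0
    with u , eu , e-same ← against-inversion ea =
    u , eu , ZeroTest.zero⇒ sameClassᶜ-zeroTest e-same , fresh
    where
    fresh : ∀ j → ∃ λ w → _ · _ ↦ w × _ ≢ w
    fresh j with w , ew , e-neq ← against-inversion (sumᶜ-zero⇒ k _ eb j) =
      w , ew , ZeroTest.zero⇒ neqᶜ-zeroTest e-neq

  newMember-complete : ∀ {k ψ} {g : Vector (Code 1) k} {i u y} {w : Vector ℕ k} →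
    ψ · i ↦ u → (∀ j → g j · i ↦ w j) → E y u → (∀ j → y ≢ w j) → newMemberᶜ ψ g · i ↓
  newMember-complete {k} {ψ} {g} {i} {u} {y} {w} eu ew Eyu fresh = mu-halts total y zero-at-y
    where
    total : ∀ y′ → ∃ (Eval₂ _ y′ i)
    total y′ with a , ea ← ZeroTest.total sameClassᶜ-zeroTest y′ u
      | b , eb ← sumᶜ-total k (λ j → against neqᶜ (g j)) {y′ ∷ i ∷ []}
                  (λ j → let z , ez = ZeroTest.total neqᶜ-zeroTest y′ (w j)
                         in z , eval-against (ew j) ez) =
      a + b , eval-comp₂ (eval-against eu ea) eb (eval-add a b)
    zero-at-y : Eval₂ _ y i 0
    zero-at-y = eval-comp₂ (eval-against eu (ZeroTest.⇒zero sameClassᶜ-zeroTest Eyu))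
      (⇒sumᶜ-zero k _ λ j → eval-against (ew j) (ZeroTest.⇒zero neqᶜ-zeroTest (fresh j)))
      (eval-add 0 0)

  ClassSizeAt : ℕ → Code 1 → ℕ → Set
  ClassSizeAt k ψ i = ∃ λ u → ψ · i ↦ u × Σ (Dom u) λ u∈A → ClassSize 𝒜′ k (u , u∈A)

  -- If ψ i had a class element outside the k listed ones on a set meeting C infinitely, searching
  -- for it would define a new member of the class of ψ, not ≈ᶜ any of the g j.
  classSize-ae : ∀ {k} (ψ : Element) → ClassSize ℬ k ψ →
    C ⊆* ClassSizeAt k (proj₁ ψ)
  classSize-ae {k} ψ@(_ , ψ-in-A , _) (g , gEψ , g-sep , g-cover) =
    ⊆*-mono classSize-at (⊆*-× (snapshot-ae ψ g gEψ g-sep) no-new-member)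
    where
    ν : Code 1
    ν = newMemberᶜ (proj₁ ψ) (λ j → proj₁ (g j))
    no-new-member : C ⊆* (λ i → ¬ ν · i ↓)
    no-new-member with cohesive-dichotomy em C-cohesive ν
    ... | inj₂ diverges = diverges
    ... | inj₁ halts = ⊥-elim (unlisted (g-cover νᴮ νEψ))
      where
      νᴮ : Element
      νᴮ = ν , (λ _ _ e → let _ , _ , Eyu , _ = newMember-sound e in proj₁ (E-dom Eyu)) , halts
      νEψ : ν Eᶜ proj₁ ψ
      νEψ = ⊆*-mono (λ { _ (y , e) → let u , eu , Eyu , _ = newMember-sound e in y , u , e , eu , Eyu })
        halts
      unlisted : ¬ ∃ λ j → ν ≈ᶜ proj₁ (g j)
      unlisted (j , ν≈gj) with _ , _ , y , e , ey ← ⊆*-witness em C-infinite ν≈gj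
        with _ , _ , _ , fresh ← newMember-sound e
        with w , ew , y≢w ← fresh j =
        y≢w (eval-deterministic ey ew)
    classSize-at : ∀ {i} → C i → Snapshot _ _ i × ¬ ν · i ↓ → ClassSizeAt k (proj₁ ψ) i
    classSize-at {i} _ (s , no-new) =
      centre , eval-centre , ψ-in-A i centre eval-centre ,
      membersᴬ , members-E , members-separated , cover
      where
      open Snapshot s
      cover : ∀ (y : Σ ℕ Dom) → E (proj₁ y) centre → ∃ λ j → proj₁ y ≡ members j
      cover (y , _) Eyu with em {∃ λ j → y ≡ members j}
      ... | yes listed = listed
      ... | no ¬listed = ⊥-elim (no-new
        (newMember-complete eval-centre eval-members Eyu (λ j y≡ → ¬listed (j , y≡))))

  classSizes-ae : ∀ {k n} (G : Vector Element n) → (∀ l → ClassSize ℬ k (G l)) →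
    C ⊆* (λ i → ∀ l → ClassSizeAt k (proj₁ (G l)) i)
  classSizes-ae G G-size = ⊆*-Π λ l → classSize-ae (G l) (G-size l)

  χᴮ⇒χᴬ : ∀ k n → χ ℬ k n → χ 𝒜′ k n
  χᴮ⇒χᴬ k n (0<k , 0<n , G , G-size , G-sep) =
    0<k , 0<n , classes-at (proj₂ (⊆*-witness em C-infinite
      (⊆*-× (classSizes-ae G G-size) (separated-ae ¬Eᶜ⇒apart G-sep))))
    where
    classes-at : ∀ {i} → C i × (∀ l → ClassSizeAt k (proj₁ (G l)) i) ×
      (∀ {w} → (∀ l → proj₁ (G l) · i ↦ w l) → Separated E w) →
      AtLeastClasses 𝒜′ (ClassSize 𝒜′ k) n
    classes-at (_ , sized , sep) = (λ l → proj₁ (sized l) , proj₁ (proj₂ (proj₂ (sized l)))) ,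
      (λ l → proj₂ (proj₂ (proj₂ (sized l)))) , sep (λ l → proj₁ (proj₂ (sized l)))

  const-classSize : ∀ {k} x → ClassSize 𝒜′ k x → ClassSize ℬ k (constᴮ x)
  const-classSize {k} (a , _) (h , hEa , h-sep , h-cover) =
    (λ j → constᴮ (h j)) , (λ j → const-Eᶜ (hEa j)) ,
    (λ j j′ hj≈hj′ → h-sep j j′ (const-≈ᶜ-reflects em C-infinite hj≈hj′)) , cover
    where
    cover : ∀ (φ : Element) → proj₁ φ Eᶜ constᶜ a → ∃ λ j → proj₁ φ ≈ᶜ constᶜ (proj₁ (h j))
    cover φ φEa with em {∃ λ j → proj₁ φ ≈ᶜ constᶜ (proj₁ (h j))}
    ... | yes listed = listed
    ... | no ¬listed
      with _ , _ , (u , v , eu , ev , Euv) , apart ← ⊆*-witness em C-infinite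
             (⊆*-× φEa (⊆*-Π λ j → ≉ᶜ⇒apart λ φ≈hj → ¬listed (j , φ≈hj)))
      with refl ← eval-deterministic (eval-const a) ev
      with j , u≡hj ← h-cover (u , proj₁ (E-dom Euv)) Euv =
      ⊥-elim (apart j eu (eval-const _) u≡hj)

  const-infinite : ∀ x → InfiniteClass 𝒜′ x → InfiniteClass ℬ (constᴮ x)
  const-infinite x x-infinite m with h , hEx , h-sep ← x-infinite m =
    (λ j → constᴮ (h j)) , (λ j → const-Eᶜ (hEx j)) ,
    λ j j′ hj≈hj′ → h-sep j j′ (const-≈ᶜ-reflects em C-infinite hj≈hj′)

  const-atLeastClasses : ∀ {Q Q′ n} → (∀ x → Q x → Q′ (constᴮ x)) →
    AtLeastClasses 𝒜′ Q n → AtLeastClasses ℬ Q′ n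
  const-atLeastClasses Q⇒Q′ (G , G-Q , G-sep) =
    (λ l → constᴮ (G l)) , (λ l → Q⇒Q′ (G l) (G-Q l)) ,
    λ l l′ Gl~Gl′ → G-sep l l′ (const-Eᶜ-reflects em C-infinite Gl~Gl′)

  χᴬ⇒χᴮ : ∀ k n → χ 𝒜′ k n → χ ℬ k n
  χᴬ⇒χᴮ k n (0<k , 0<n , classes) = 0<k , 0<n ,
    const-atLeastClasses {ClassSize 𝒜′ k} {ClassSize ℬ k} const-classSize classes

  χᴮ⇔χᴬ : ∀ k n → χ ℬ k n ⇔ χ 𝒜′ k n
  χᴮ⇔χᴬ k n = χᴮ⇒χᴬ k n , χᴬ⇒χᴮ k n

-- Abstract equivalence structures

record IsEqStr (𝒮 : Str) : Set where
  open Str 𝒮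
  field
    ≈-refl : ∀ {x} → x ≈ x
    ≈-sym : Symmetric _≈_
    ≈-trans : Transitive _≈_
    R-refl : ∀ {x} → R x x
    R-sym : Symmetric R
    R-trans : Transitive R
    ≈⇒R : ∀ {x y} → x ≈ y → R x y

Enumerable : Str → Set
Enumerable 𝒮 = Σ (ℕ → Maybe Carrier) λ enum → ∀ x → ∃₂ λ n a → enum n ≡ just a × a ≈ x
  where open Str 𝒮

data ClassType : Set where
  finite : ℕ → ClassType
  infinite : ClassType

HasType : (𝒮 : Str) → ClassType → Str.Carrier 𝒮 → Set
HasType 𝒮 (finite k) = ClassSize 𝒮 k
HasType 𝒮 infinite = InfiniteClass 𝒮

module ClassTheory (em : ExcludedMiddle 0ℓ) (𝒮 : Str) (𝒮-eq : IsEqStr 𝒮) where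
  open Str 𝒮
  open IsEqStr 𝒮-eq

  ClassSize-respR : ∀ {k x y} → R x y → ClassSize 𝒮 k x → ClassSize 𝒮 k y
  ClassSize-respR xRy (g , gRx , g-sep , g-cover) =
    g , (λ i → R-trans (gRx i) xRy) , g-sep , λ z zRy → g-cover z (R-trans zRy (R-sym xRy))

  InfiniteClass-respR : ∀ {x y} → R x y → InfiniteClass 𝒮 x → InfiniteClass 𝒮 y
  InfiniteClass-respR xRy x-infinite m with g , gRx , g-sep ← x-infinite m =
    g , (λ i → R-trans (gRx i) xRy) , g-sep

  HasType-respR : ∀ t {x y} → R x y → HasType 𝒮 t x → HasType 𝒮 t y
  HasType-respR (finite k) = ClassSize-respR
  HasType-respR infinite = InfiniteClass-respR

  ¬ClassSize-0 : ∀ {x} → ¬ ClassSize 𝒮 0 x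
  ¬ClassSize-0 {x} (_ , _ , _ , cover) with () ← proj₁ (cover x R-refl)

  separated-members≤size : ∀ {m k x} {g : Vector Carrier m} → (∀ i → R (g i) x) →
    Separated _≈_ g → ClassSize 𝒮 k x → m ≤ k
  separated-members≤size gRx g-sep (h , _ , _ , h-cover) =
    separated-cover⇒≤ {_~_ = _≈_} ≈-sym ≈-trans h g-sep (λ i → h-cover _ (gRx i))

  ClassSize-unique : ∀ {k k′ x} → ClassSize 𝒮 k x → ClassSize 𝒮 k′ x → k ≡ k′
  ClassSize-unique size@(g , gRx , g-sep , _) size′@(h , hRx , h-sep , _) =
    ≤-antisym (separated-members≤size gRx g-sep size′) (separated-members≤size hRx h-sep size)

  ClassSize⇒¬InfiniteClass : ∀ {k x} → ClassSize 𝒮 k x → ¬ InfiniteClass 𝒮 x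
  ClassSize⇒¬InfiniteClass {k} size x-infinite with g , gRx , g-sep ← x-infinite (suc k) =
    1+n≰n (separated-members≤size gRx g-sep size)

  FiniteClass⊎InfiniteClass : ∀ x → FiniteClass 𝒮 x ⊎ InfiniteClass 𝒮 x
  FiniteClass⊎InfiniteClass x with em {FiniteClass 𝒮 x}
  ... | yes finite-class = inj₁ finite-class
  ... | no ¬finite-class = inj₂ members
    where
    members : InfiniteClass 𝒮 x
    members zero = (λ ()) , (λ ()) , (λ ())
    members (suc m) with g , gRx , g-sep ← members m
      with em {∃ λ y → R y x × (∀ i → ¬ y ≈ g i)}
    ... | yes (y , yRx , y-new) =
      y ∷ᶠ g , ∷-all {P = λ z → R z x} yRx gRx , ∷-separated {_~_ = _≈_} ≈-sym {x = y} y-new g-sep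
    ... | no ¬new = ⊥-elim (¬finite-class (m , g , gRx , g-sep , cover))
      where
      cover : ∀ y → R y x → ∃ λ i → y ≈ g i
      cover y yRx with em {∃ λ i → y ≈ g i}
      ... | yes listed = listed
      ... | no ¬listed = ⊥-elim (¬new (y , yRx , λ i y≈gi → ¬listed (i , y≈gi)))

  classType : ∀ x → ∃ λ t → HasType 𝒮 t x
  classType x with FiniteClass⊎InfiniteClass x
  ... | inj₁ (k , size) = finite k , size
  ... | inj₂ x-infinite = infinite , x-infinite

  HasType-unique : ∀ {t t′ x} → HasType 𝒮 t x → HasType 𝒮 t′ x → t ≡ t′
  HasType-unique {finite k} {finite k′} size size′ = cong finite (ClassSize-unique size size′)
  HasType-unique {finite k} {infinite} size x-infinite = ⊥-elim (ClassSize⇒¬InfiniteClass size x-infinite)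
  HasType-unique {infinite} {finite k} x-infinite size = ⊥-elim (ClassSize⇒¬InfiniteClass size x-infinite)
  HasType-unique {infinite} {infinite} _ _ = refl

  record Representatives (t : ClassType) {n} (a : Vector Carrier n) : Set where
    field
      count : ℕ
      index : Fin count → Fin n
      index-type : ∀ l → HasType 𝒮 t (a (index l))
      index-separated : Separated R (λ l → a (index l))
      cover : ∀ j → HasType 𝒮 t (a j) → ∃ λ l → R (a j) (a (index l))

  representatives : ∀ t {n} (a : Vector Carrier n) → Representatives t a
  representatives t {zero} a = record
    { count = 0 ; index = λ () ; index-type = λ () ; index-separated = λ () ; cover = λ () }
  representatives t {suc n} a
    with reps ← representatives t (λ j → a (suc j))
    | em {HasType 𝒮 t (a zero)} | em {∃ λ l → R (a zero) (a (suc (Representatives.index reps l)))}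
  ... | yes a₀-type | no a₀-new = record
    { count = suc count ; index = zero ∷ᶠ (λ l → suc (index l))
    ; index-type = index-type′ ; index-separated = separated ; cover = cover′ }
    where
    open Representatives reps
    index-type′ : ∀ l → HasType 𝒮 t (a ((zero ∷ᶠ (λ l → suc (index l))) l))
    index-type′ zero = a₀-type
    index-type′ (suc l) = index-type l
    separated : Separated R (λ l → a ((zero ∷ᶠ (λ l → suc (index l))) l))
    separated zero zero _ = refl
    separated zero (suc l′) a₀Ra = ⊥-elim (a₀-new (l′ , a₀Ra))
    separated (suc l) zero aRa₀ = ⊥-elim (a₀-new (l , R-sym aRa₀))
    separated (suc l) (suc l′) aRa = cong suc (index-separated l l′ aRa)
    cover′ : ∀ j → HasType 𝒮 t (a j) → ∃ λ l → R (a j) (a ((zero ∷ᶠ (λ l → suc (index l))) l))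
    cover′ zero _ = zero , R-refl
    cover′ (suc j) aj-type with l , ajRa ← cover j aj-type = suc l , ajRa
  ... | yes _ | yes (l₀ , a₀Ra) = record
    { count = count ; index = λ l → suc (index l)
    ; index-type = index-type ; index-separated = index-separated ; cover = cover′ }
    where
    open Representatives reps
    cover′ : ∀ j → HasType 𝒮 t (a j) → ∃ λ l → R (a j) (a (suc (index l)))
    cover′ zero _ = l₀ , a₀Ra
    cover′ (suc j) = cover j
  ... | no ¬a₀-type | _ = record
    { count = count ; index = λ l → suc (index l)
    ; index-type = index-type ; index-separated = index-separated ; cover = cover′ }
    where
    open Representatives reps
    cover′ : ∀ j → HasType 𝒮 t (a j) → ∃ λ l → R (a j) (a (suc (index l)))
    cover′ zero a₀-type = ⊥-elim (¬a₀-type a₀-type)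
    cover′ (suc j) = cover j

-- Back and forth

module _ (𝒮 𝒯 : Str) where
  private
    module S = Str 𝒮
    module T = Str 𝒯

  record PartialIso {n} (a : Vector S.Carrier n) (b : Vector T.Carrier n) : Set where
    field
      ≈-agree : ∀ i j → a i S.≈ a j ⇔ b i T.≈ b j
      R-agree : ∀ i j → S.R (a i) (a j) ⇔ T.R (b i) (b j)
      same-type : ∀ i → ∃ λ t → HasType 𝒮 t (a i) × HasType 𝒯 t (b i)

PartialIso-swap : ∀ {𝒮 𝒯 n} {a : Vector (Str.Carrier 𝒮) n} {b : Vector (Str.Carrier 𝒯) n} →
  PartialIso 𝒮 𝒯 a b → PartialIso 𝒯 𝒮 b a
PartialIso-swap π = record
  { ≈-agree = λ i j → swap (≈-agree i j) ; R-agree = λ i j → swap (R-agree i j)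
  ; same-type = λ i → let t , ta , tb = same-type i in t , tb , ta }
  where open PartialIso π

module Extension (em : ExcludedMiddle 0ℓ) (𝒮 𝒯 : Str) (𝒮-eq : IsEqStr 𝒮) (𝒯-eq : IsEqStr 𝒯)
  (enough-classes : ∀ t n → AtLeastClasses 𝒮 (HasType 𝒮 t) (suc n) →
                            AtLeastClasses 𝒯 (HasType 𝒯 t) (suc n)) where
  private
    module S = Str 𝒮
    module T = Str 𝒯
    module Sᵉ = IsEqStr 𝒮-eq
    module Tᵉ = IsEqStr 𝒯-eq
    module Sᶜ = ClassTheory em 𝒮 𝒮-eq
    module Tᶜ = ClassTheory em 𝒯 𝒯-eq

  PartialIso-∷ : ∀ {n} {a : Vector S.Carrier n} {b : Vector T.Carrier n} {x y} →
    PartialIso 𝒮 𝒯 a b → (∃ λ t → HasType 𝒮 t x × HasType 𝒯 t y) →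
    (∀ j → x S.≈ a j ⇔ y T.≈ b j) → (∀ j → S.R x (a j) ⇔ T.R y (b j)) →
    PartialIso 𝒮 𝒯 (x ∷ᶠ a) (y ∷ᶠ b)
  PartialIso-∷ {a = a} {b} {x} {y} π xy-type ≈-new R-new = record
    { ≈-agree = extend-agree {_~_ = S._≈_} {T._≈_} Sᵉ.≈-refl Tᵉ.≈-refl Sᵉ.≈-sym Tᵉ.≈-sym ≈-new ≈-agree
    ; R-agree = extend-agree {_~_ = S.R} {T.R} Sᵉ.R-refl Tᵉ.R-refl Sᵉ.R-sym Tᵉ.R-sym R-new R-agree
    ; same-type = same-type′ }
    where
    open PartialIso π
    same-type′ : ∀ i → ∃ λ t → HasType 𝒮 t ((x ∷ᶠ a) i) × HasType 𝒯 t ((y ∷ᶠ b) i)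
    same-type′ zero = xy-type
    same-type′ (suc i) = same-type i
    extend-agree : {_~_ : S.Carrier → S.Carrier → Set} {_~′_ : T.Carrier → T.Carrier → Set} →
      (∀ {x} → x ~ x) → (∀ {y} → y ~′ y) → Symmetric _~_ → Symmetric _~′_ →
      (∀ j → x ~ a j ⇔ y ~′ b j) → (∀ i j → a i ~ a j ⇔ b i ~′ b j) →
      ∀ i j → (x ∷ᶠ a) i ~ (x ∷ᶠ a) j ⇔ (y ∷ᶠ b) i ~′ (y ∷ᶠ b) j
    extend-agree refl₁ refl₂ sym₁ sym₂ new old zero zero = (λ _ → refl₂) , (λ _ → refl₁)
    extend-agree refl₁ refl₂ sym₁ sym₂ new old zero (suc j) = new j
    extend-agree refl₁ refl₂ sym₁ sym₂ new old (suc i) zero =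
      (λ ai~x → sym₂ (proj₁ (new i) (sym₁ ai~x))) , (λ bi~y → sym₁ (proj₂ (new i) (sym₂ bi~y)))
    extend-agree refl₁ refl₂ sym₁ sym₂ new old (suc i) (suc j) = old i j

  module _ {n} {a : Vector S.Carrier n} {b : Vector T.Carrier n} (π : PartialIso 𝒮 𝒯 a b) where
    open PartialIso π

    -- The class of b i₀ has as many elements as that of a i₀, which already holds x besides the a j.
    new-member : ∀ {x} i₀ → S.R x (a i₀) → (∀ j → ¬ x S.≈ a j) →
      ∃ λ y → T.R y (b i₀) × (∀ j → ¬ y T.≈ b j)
    new-member {x} i₀ xRa x-new with em {∃ λ y → T.R y (b i₀) × (∀ j → ¬ y T.≈ b j)}
    ... | yes found = found
    ... | no none = ⊥-elim (too-many (same-type i₀))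
      where
      listed : ∀ {y} → T.R y (b i₀) → ∃ λ j → y T.≈ b j
      listed {y} yRb with em {∃ λ j → y T.≈ b j}
      ... | yes found = found
      ... | no ¬found = ⊥-elim (none (y , yRb , λ j y≈bj → ¬found (j , y≈bj)))
      too-many : ∃ (λ t → HasType 𝒮 t (a i₀) × HasType 𝒯 t (b i₀)) → ⊥
      too-many (infinite , _ , b-infinite) with h , hRb , h-sep ← b-infinite (suc n) =
        1+n≰n (separated-cover⇒≤ {_~_ = T._≈_} Tᵉ.≈-sym Tᵉ.≈-trans b h-sep (λ l → listed (hRb l)))
      too-many (finite k , a-size , (h , hRb , h-sep , _)) =
        1+n≰n (Sᶜ.separated-members≤size (∷-all {P = λ z → S.R z (a i₀)} xRa ajRa)
          (∷-separated {_~_ = S._≈_} Sᵉ.≈-sym {x = x} {f = λ l → a (j l)} (λ l → x-new (j l)) aj-sep)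
          a-size)
        where
        j : Fin k → Fin n
        j l = proj₁ (listed (hRb l))
        h≈bj : ∀ l → h l T.≈ b (j l)
        h≈bj l = proj₂ (listed (hRb l))
        ajRa : ∀ l → S.R (a (j l)) (a i₀)
        ajRa l = proj₂ (R-agree (j l) i₀) (Tᵉ.R-trans (Tᵉ.≈⇒R (Tᵉ.≈-sym (h≈bj l))) (hRb l))
        aj-sep : Separated S._≈_ (λ l → a (j l))
        aj-sep l l′ aj≈aj′ = h-sep l l′
          (Tᵉ.≈-trans (h≈bj l) (Tᵉ.≈-trans (proj₁ (≈-agree (j l) (j l′)) aj≈aj′) (Tᵉ.≈-sym (h≈bj l′))))

    -- Together with x, the type-t classes among the a j outnumber those among the b j.
    new-class : ∀ {x} t → HasType 𝒮 t x → (∀ j → ¬ S.R x (a j)) →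
      ∃ λ y → HasType 𝒯 t y × (∀ j → ¬ T.R y (b j))
    new-class {x} t x-type x-alone
      with em {∃ λ y → HasType 𝒯 t y × (∀ j → ¬ T.R y (b j))}
    ... | yes found = found
    ... | no none = ⊥-elim (1+n≰n (separated-cover⇒≤ {_~_ = T.R} Tᵉ.R-sym Tᵉ.R-trans
            (λ l → b (index l)) H-sep (λ l → representative l , HRb l)))
      where
      open Sᶜ.Representatives (Sᶜ.representatives t a)
      classes : AtLeastClasses 𝒯 (HasType 𝒯 t) (suc count)
      classes = enough-classes t count ((x ∷ᶠ λ l → a (index l)) ,
        ∷-all {P = HasType 𝒮 t} x-type index-type ,
        ∷-separated {_~_ = S.R} Sᵉ.R-sym {x = x} {f = λ l → a (index l)}
          (λ l → x-alone (index l)) index-separated)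
      H : Vector T.Carrier (suc count)
      H = proj₁ classes
      H-type : ∀ l → HasType 𝒯 t (H l)
      H-type = proj₁ (proj₂ classes)
      H-sep : Separated T.R H
      H-sep = proj₂ (proj₂ classes)
      met : ∀ l → ∃ λ j → T.R (H l) (b j)
      met l with em {∃ λ j → T.R (H l) (b j)}
      ... | yes found = found
      ... | no ¬found = ⊥-elim (none (H l , H-type l , λ j HRb → ¬found (j , HRb)))
      a-type : ∀ l → HasType 𝒮 t (a (proj₁ (met l)))
      a-type l with t′ , at′ , bt′ ← same-type (proj₁ (met l))
        with refl ← Tᶜ.HasType-unique {t′} {t} bt′ (Tᶜ.HasType-respR t (proj₂ (met l)) (H-type l)) = at′
      representative : Fin (suc count) → Fin count
      representative l = proj₁ (cover (proj₁ (met l)) (a-type l))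
      HRb : ∀ l → T.R (H l) (b (index (representative l)))
      HRb l = Tᵉ.R-trans (proj₂ (met l))
        (proj₁ (R-agree _ _) (proj₂ (cover (proj₁ (met l)) (a-type l))))

    extend : ∀ x → ∃ λ y → PartialIso 𝒮 𝒯 (x ∷ᶠ a) (y ∷ᶠ b)
    extend x with em {∃ λ i → x S.≈ a i}
    ... | yes (i₀ , x≈a) = b i₀ , PartialIso-∷ π type ≈-new R-new
      where
      type : ∃ λ t → HasType 𝒮 t x × HasType 𝒯 t (b i₀)
      type with t , at , bt ← same-type i₀ = t , Sᶜ.HasType-respR t (Sᵉ.R-sym (Sᵉ.≈⇒R x≈a)) at , bt
      ≈-new : ∀ j → x S.≈ a j ⇔ b i₀ T.≈ b j
      ≈-new j = (λ x≈aj → proj₁ (≈-agree i₀ j) (Sᵉ.≈-trans (Sᵉ.≈-sym x≈a) x≈aj)) ,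
                (λ b≈bj → Sᵉ.≈-trans x≈a (proj₂ (≈-agree i₀ j) b≈bj))
      R-new : ∀ j → S.R x (a j) ⇔ T.R (b i₀) (b j)
      R-new j = (λ xRaj → proj₁ (R-agree i₀ j) (Sᵉ.R-trans (Sᵉ.R-sym (Sᵉ.≈⇒R x≈a)) xRaj)) ,
                (λ bRbj → Sᵉ.R-trans (Sᵉ.≈⇒R x≈a) (proj₂ (R-agree i₀ j) bRbj))
    ... | no x-new with em {∃ λ i → S.R x (a i)}
    ... | yes (i₀ , xRa)
      with y , yRb , y-new ← new-member i₀ xRa (λ j x≈aj → x-new (j , x≈aj)) =
      y , PartialIso-∷ π type ≈-new R-new
      where
      type : ∃ λ t → HasType 𝒮 t x × HasType 𝒯 t y
      type with t , at , bt ← same-type i₀ =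
        t , Sᶜ.HasType-respR t (Sᵉ.R-sym xRa) at , Tᶜ.HasType-respR t (Tᵉ.R-sym yRb) bt
      ≈-new : ∀ j → x S.≈ a j ⇔ y T.≈ b j
      ≈-new j = (λ x≈aj → ⊥-elim (x-new (j , x≈aj))) , (λ y≈bj → ⊥-elim (y-new j y≈bj))
      R-new : ∀ j → S.R x (a j) ⇔ T.R y (b j)
      R-new j = (λ xRaj → Tᵉ.R-trans yRb (proj₁ (R-agree i₀ j) (Sᵉ.R-trans (Sᵉ.R-sym xRa) xRaj))) ,
                (λ yRbj → Sᵉ.R-trans xRa (proj₂ (R-agree i₀ j) (Tᵉ.R-trans (Tᵉ.R-sym yRb) yRbj)))
    ... | no x-alone with t , x-type ← Sᶜ.classType x
      with y , y-type , y-alone ← new-class t x-type (λ j xRaj → x-alone (j , xRaj)) =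
      y , PartialIso-∷ π (t , x-type , y-type) ≈-new R-new
      where
      ≈-new : ∀ j → x S.≈ a j ⇔ y T.≈ b j
      ≈-new j = (λ x≈aj → ⊥-elim (x-alone (j , Sᵉ.≈⇒R x≈aj))) ,
                (λ y≈bj → ⊥-elim (y-alone j (Tᵉ.≈⇒R y≈bj)))
      R-new : ∀ j → S.R x (a j) ⇔ T.R y (b j)
      R-new j = (λ xRaj → ⊥-elim (x-alone (j , xRaj))) , (λ yRbj → ⊥-elim (y-alone j yRbj))

module BackAndForth (em : ExcludedMiddle 0ℓ) (𝒮 𝒯 : Str) (𝒮-eq : IsEqStr 𝒮) (𝒯-eq : IsEqStr 𝒯)
  (𝒮-enum : Enumerable 𝒮) (𝒯-enum : Enumerable 𝒯)
  (forth-classes : ∀ t n → AtLeastClasses 𝒮 (HasType 𝒮 t) (suc n) →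
                           AtLeastClasses 𝒯 (HasType 𝒯 t) (suc n))
  (back-classes : ∀ t n → AtLeastClasses 𝒯 (HasType 𝒯 t) (suc n) →
                          AtLeastClasses 𝒮 (HasType 𝒮 t) (suc n)) where
  private
    module S = Str 𝒮
    module T = Str 𝒯
    module Sᵉ = IsEqStr 𝒮-eq
    module Tᵉ = IsEqStr 𝒯-eq
    module Forth = Extension em 𝒮 𝒯 𝒮-eq 𝒯-eq forth-classes
    module Back = Extension em 𝒯 𝒮 𝒯-eq 𝒮-eq back-classes

  record Stage : Set where
    field
      {size} : ℕ
      left : Vector S.Carrier size
      right : Vector T.Carrier size
      partial : PartialIso 𝒮 𝒯 left right

  _∈ˢ_ : S.Carrier × T.Carrier → Stage → Set
  (x , y) ∈ˢ st = ∃ λ i → left i ≡ x × right i ≡ y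
    where open Stage st

  forth : Stage → Maybe S.Carrier → Stage
  forth st nothing = st
  forth st (just x) = record { left = x ∷ᶠ left ; right = y ∷ᶠ right ; partial = π }
    where
    open Stage st
    y = proj₁ (Forth.extend partial x)
    π = proj₂ (Forth.extend partial x)

  back : Stage → Maybe T.Carrier → Stage
  back st nothing = st
  back st (just y) = record { left = x ∷ᶠ left ; right = y ∷ᶠ right ; partial = PartialIso-swap π }
    where
    open Stage st
    x = proj₁ (Back.extend (PartialIso-swap partial) y)
    π = proj₂ (Back.extend (PartialIso-swap partial) y)

  stage : ℕ → Stage
  stage zero = record
    { size = 0 ; left = λ () ; right = λ ()
    ; partial = record { ≈-agree = λ () ; R-agree = λ () ; same-type = λ () } }
  stage (suc s) = back (forth (stage s) (proj₁ 𝒮-enum s)) (proj₁ 𝒯-enum s)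

  forth-mono : ∀ st m {q} → q ∈ˢ st → q ∈ˢ forth st m
  forth-mono st nothing q∈ = q∈
  forth-mono st (just x) (i , eqs) = suc i , eqs

  back-mono : ∀ st m {q} → q ∈ˢ st → q ∈ˢ back st m
  back-mono st nothing q∈ = q∈
  back-mono st (just y) (i , eqs) = suc i , eqs

  stage-mono : ∀ s d {q} → q ∈ˢ stage s → q ∈ˢ stage (d + s)
  stage-mono s zero q∈ = q∈
  stage-mono s (suc d) q∈ =
    back-mono _ (proj₁ 𝒯-enum (d + s)) (forth-mono _ (proj₁ 𝒮-enum (d + s)) (stage-mono s d q∈))

  ∈ˢ-agree : ∀ st {x y x′ y′} → (x , y) ∈ˢ st → (x′ , y′) ∈ˢ st →
    (x S.≈ x′ ⇔ y T.≈ y′) × (S.R x x′ ⇔ T.R y y′)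
  ∈ˢ-agree st (i , refl , refl) (j , refl , refl) = ≈-agree i j , R-agree i j
    where open PartialIso (Stage.partial st)

  agree : ∀ s s′ {x y x′ y′} → (x , y) ∈ˢ stage s → (x′ , y′) ∈ˢ stage s′ →
    (x S.≈ x′ ⇔ y T.≈ y′) × (S.R x x′ ⇔ T.R y y′)
  agree s s′ {x′ = x′} {y′} xy∈ xy′∈ = ∈ˢ-agree (stage (s′ + s)) (stage-mono s s′ xy∈)
    (subst (λ s″ → (x′ , y′) ∈ˢ stage s″) (+-comm s s′) (stage-mono s′ s xy′∈))

  forth-just : ∀ st {m x} → m ≡ just x → (x , proj₁ (Forth.extend (Stage.partial st) x)) ∈ˢ forth st m
  forth-just st refl = zero , refl , refl

  back-just : ∀ st {m y} → m ≡ just y → ∃ λ x → (x , y) ∈ˢ back st m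
  back-just st refl = _ , zero , refl , refl

  image : S.Carrier → T.Carrier
  image x with s , x′ , _ ← proj₂ 𝒮-enum x = proj₁ (Forth.extend (Stage.partial (stage s)) x′)

  image-∈ˢ : ∀ x → ∃₂ λ s x′ → x′ S.≈ x × (x′ , image x) ∈ˢ stage s
  image-∈ˢ x with s , x′ , enum≡x′ , x′≈x ← proj₂ 𝒮-enum x =
    suc s , x′ , x′≈x , back-mono _ (proj₁ 𝒯-enum s) (forth-just (stage s) enum≡x′)

  isomorphism : 𝒮 ≅ 𝒯
  isomorphism = image , ≈-preserved , surjective , R-preserved
    where
    ≈-preserved : ∀ x x′ → x S.≈ x′ ⇔ image x T.≈ image x′
    ≈-preserved x x′ with s , z , z≈x , z∈ ← image-∈ˢ x | s′ , z′ , z′≈x′ , z′∈ ← image-∈ˢ x′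
      with (≈⇒ , ⇐≈) , _ ← agree s s′ z∈ z′∈ =
      (λ x≈x′ → ≈⇒ (Sᵉ.≈-trans z≈x (Sᵉ.≈-trans x≈x′ (Sᵉ.≈-sym z′≈x′)))) ,
      (λ ix≈ix′ → Sᵉ.≈-trans (Sᵉ.≈-sym z≈x) (Sᵉ.≈-trans (⇐≈ ix≈ix′) z′≈x′))
    R-preserved : ∀ x x′ → S.R x x′ ⇔ T.R (image x) (image x′)
    R-preserved x x′ with s , z , z≈x , z∈ ← image-∈ˢ x | s′ , z′ , z′≈x′ , z′∈ ← image-∈ˢ x′
      with _ , (R⇒ , ⇐R) ← agree s s′ z∈ z′∈ =
      (λ xRx′ → R⇒ (Sᵉ.R-trans (Sᵉ.≈⇒R z≈x) (Sᵉ.R-trans xRx′ (Sᵉ.≈⇒R (Sᵉ.≈-sym z′≈x′))))) ,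
      (λ ixRix′ → Sᵉ.R-trans (Sᵉ.≈⇒R (Sᵉ.≈-sym z≈x)) (Sᵉ.R-trans (⇐R ixRix′) (Sᵉ.≈⇒R z′≈x′)))
    surjective : ∀ y → ∃ λ x → image x T.≈ y
    surjective y with s , y′ , enum≡y′ , y′≈y ← proj₂ 𝒯-enum y
      with x , xy′∈ ← back-just (forth (stage s) (proj₁ 𝒮-enum s)) enum≡y′
      with s′ , z , z≈x , z∈ ← image-∈ˢ x
      with (≈⇒ , _) , _ ← agree s′ (suc s) z∈ xy′∈ =
      x , Tᵉ.≈-trans (≈⇒ z≈x) y′≈y

≅-from-invariants : ExcludedMiddle 0ℓ → ∀ {𝒮 𝒯} → IsEqStr 𝒮 → IsEqStr 𝒯 →
  Enumerable 𝒮 → Enumerable 𝒯 → (∀ k n → χ 𝒮 k n ⇔ χ 𝒯 k n) →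
  (∀ n → AtLeastClasses 𝒮 (InfiniteClass 𝒮) n ⇔ AtLeastClasses 𝒯 (InfiniteClass 𝒯) n) → 𝒮 ≅ 𝒯
≅-from-invariants em {𝒮} {𝒯} 𝒮-eq 𝒯-eq 𝒮-enum 𝒯-enum same-χ same-infinite =
  BackAndForth.isomorphism em 𝒮 𝒯 𝒮-eq 𝒯-eq 𝒮-enum 𝒯-enum
    (classes-of-type 𝒮-eq (λ k n → proj₁ (same-χ k n)) (λ n → proj₁ (same-infinite n)))
    (classes-of-type 𝒯-eq (λ k n → proj₂ (same-χ k n)) (λ n → proj₂ (same-infinite n)))
  where
  classes-of-type : ∀ {𝒰 𝒱} → IsEqStr 𝒰 → (∀ k n → χ 𝒰 k n → χ 𝒱 k n) →
    (∀ n → AtLeastClasses 𝒰 (InfiniteClass 𝒰) n → AtLeastClasses 𝒱 (InfiniteClass 𝒱) n) →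
    ∀ t n → AtLeastClasses 𝒰 (HasType 𝒰 t) (suc n) → AtLeastClasses 𝒱 (HasType 𝒱 t) (suc n)
  classes-of-type {𝒰} 𝒰-eq _ _ (finite zero) n (_ , size₀ , _) =
    ⊥-elim (ClassTheory.¬ClassSize-0 em 𝒰 𝒰-eq (size₀ zero))
  classes-of-type _ χ⊆ _ (finite (suc k)) n classes =
    proj₂ (proj₂ (χ⊆ (suc k) (suc n) (s≤s z≤n , s≤s z≤n , classes)))
  classes-of-type _ _ infinite⊆ infinite n = infinite⊆ (suc n)

-- Countability

-- The binary digits 1+[2_] and 2[1+_] spell out k in unary, then stop.
unary : ℕ → ℕᵇ → ℕᵇ
unary zero r = 1+[2 r ]
unary (suc k) r = 2[1+ unary k r ]

unary-injective : ∀ a b {r r′} → unary a r ≡ unary b r′ → a ≡ b × r ≡ r′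
unary-injective zero zero refl = refl , refl
unary-injective (suc a) (suc b) eq with refl , r≡r′ ← unary-injective a b (2[1+_]-injective eq) =
  refl , r≡r′

tag : ∀ {n} → Code n → ℕ
tag Z = 0
tag S = 1
tag (P _) = 2
tag (comp _ _) = 3
tag (rec _ _) = 4
tag (mu _) = 5

mutual
  body : ∀ {n} → Code n → ℕᵇ → ℕᵇ
  body Z r = r
  body S r = r
  body (P i) r = unary (toℕ i) r
  body (comp {m = m} f gs) r = unary m (encode f (encodeAll gs r))
  body (rec g h) r = encode g (encode h r)
  body (mu f) r = encode f r

  encode : ∀ {n} → Code n → ℕᵇ → ℕᵇ
  encode c r = unary (tag c) (body c r)

  encodeAll : ∀ {n m} → Vec (Code n) m → ℕᵇ → ℕᵇ
  encodeAll [] r = r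
  encodeAll (g ∷ gs) r = encode g (encodeAll gs r)

mutual
  encode-injective : ∀ {n} (c c′ : Code n) {r r′} → encode c r ≡ encode c′ r′ → c ≡ c′ × r ≡ r′
  encode-injective c c′ eq with tags , bodies ← unary-injective (tag c) (tag c′) eq =
    body-injective c c′ tags bodies

  body-injective : ∀ {n} (c c′ : Code n) {r r′} → tag c ≡ tag c′ → body c r ≡ body c′ r′ →
    c ≡ c′ × r ≡ r′
  body-injective Z Z _ eq = refl , eq
  body-injective S S _ eq = refl , eq
  body-injective (P i) (P j) _ eq
    with i≡j , r≡r′ ← unary-injective (toℕ i) (toℕ j) eq
    with refl ← toℕ-injective i≡j = refl , r≡r′
  body-injective (comp {m = m} f gs) (comp {m = m′} f′ gs′) _ eq
    with refl , eq₁ ← unary-injective m m′ eq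
    with refl , eq₂ ← encode-injective f f′ eq₁
    with refl , r≡r′ ← encodeAll-injective gs gs′ eq₂ = refl , r≡r′
  body-injective (rec g h) (rec g′ h′) _ eq
    with refl , eq₁ ← encode-injective g g′ eq
    with refl , r≡r′ ← encode-injective h h′ eq₁ = refl , r≡r′
  body-injective (mu f) (mu f′) _ eq with refl , r≡r′ ← encode-injective f f′ eq = refl , r≡r′

  encodeAll-injective : ∀ {n m} (gs gs′ : Vec (Code n) m) {r r′} →
    encodeAll gs r ≡ encodeAll gs′ r′ → gs ≡ gs′ × r ≡ r′
  encodeAll-injective [] [] eq = refl , eq
  encodeAll-injective (g ∷ gs) (g′ ∷ gs′) eq
    with refl , eq₁ ← encode-injective g g′ eq
    with refl , r≡r′ ← encodeAll-injective gs gs′ eq₁ = refl , r≡r′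

code : ∀ {n} → Code n → ℕ
code c = ℕᵇ⇒ℕ (encode c 0ᵇ)

code-injective : ∀ {n} (c c′ : Code n) → code c ≡ code c′ → c ≡ c′
code-injective c c′ eq = proj₁ (encode-injective c c′ (ℕᵇ⇒ℕ-injective eq))

module _ (em : ExcludedMiddle 0ℓ) (𝒮 : Str) where
  open Str 𝒮

  injection⇒enumerable : (f : Carrier → ℕ) → (∀ x y → f x ≡ f y → x ≈ y) → Enumerable 𝒮
  injection⇒enumerable f f-injective = (λ n → preimage (em {∃ λ x → f x ≡ n})) , λ x →
    f x , found x (em {∃ λ x′ → f x′ ≡ f x})
    where
    preimage : ∀ {n} → Dec (∃ λ x → f x ≡ n) → Maybe Carrier
    preimage (yes (x , _)) = just x
    preimage (no _) = nothing
    found : ∀ x (d : Dec (∃ λ x′ → f x′ ≡ f x)) → ∃ λ x′ → preimage d ≡ just x′ × x′ ≈ x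
    found x (yes (x′ , fx′≡fx)) = x′ , refl , f-injective x′ x fx′≡fx
    found x (no none) = ⊥-elim (none (x , refl))

-- Finitely many finite classes

sumᵛ : ∀ {n} → Vector ℕ n → ℕ
sumᵛ {zero} _ = 0
sumᵛ {suc n} v = v zero + sumᵛ (λ i → v (suc i))

≤-sumᵛ : ∀ {n} (v : Vector ℕ n) i → v i ≤ sumᵛ v
≤-sumᵛ v zero = m≤m+n (v zero) _
≤-sumᵛ v (suc i) = ≤-trans (≤-sumᵛ (λ i → v (suc i)) i) (m≤n+m _ (v zero))

AtLeastClasses-none : ∀ {𝒮 𝒯 : Str} {Q : Str.Carrier 𝒮 → Set} {Q′ : Str.Carrier 𝒯 → Set} →
  (∀ x → ¬ Q x) → (∀ y → ¬ Q′ y) → ∀ n → AtLeastClasses 𝒮 Q n ⇔ AtLeastClasses 𝒯 Q′ n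
AtLeastClasses-none _ _ zero = (λ _ → (λ ()) , (λ ()) , (λ ())) , (λ _ → (λ ()) , (λ ()) , (λ ()))
AtLeastClasses-none ¬Q ¬Q′ (suc n) =
  (λ (G , G-Q , _) → ⊥-elim (¬Q (G zero) (G-Q zero))) ,
  (λ (G , G-Q′ , _) → ⊥-elim (¬Q′ (G zero) (G-Q′ zero)))

module FiniteClasses (em : ExcludedMiddle 0ℓ) (𝒮 : Str) (𝒮-eq : IsEqStr 𝒮) where
  open Str 𝒮
  open IsEqStr 𝒮-eq
  open ClassTheory em 𝒮 𝒮-eq

  Covering : ∀ {n} → Vector Carrier n → Set
  Covering g = ∀ x → ∃ λ i → R x (g i)

  covering⊎more : NoInfiniteClasses 𝒮 → ∀ {n} → (G : AtLeastClasses 𝒮 (FiniteClass 𝒮) n) →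
    Covering (proj₁ G) ⊎ AtLeastClasses 𝒮 (FiniteClass 𝒮) (suc n)
  covering⊎more none (g , g-finite , g-sep) with em {∃ λ x → ∀ i → ¬ R x (g i)}
  ... | yes (x , x-new) = inj₂ (x ∷ᶠ g , ∷-all {P = FiniteClass 𝒮} x-finite g-finite ,
                                 ∷-separated {_~_ = R} R-sym {x = x} x-new g-sep)
    where
    x-finite : FiniteClass 𝒮 x
    x-finite with FiniteClass⊎InfiniteClass x
    ... | inj₁ finite-class = finite-class
    ... | inj₂ x-infinite = ⊥-elim (none x x-infinite)
  ... | no ¬new = inj₁ cover
    where
    cover : Covering g
    cover x with em {∃ λ i → R x (g i)}
    ... | yes found = found
    ... | no ¬found = ⊥-elim (¬new (x , λ i xRgi → ¬found (i , xRgi)))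

  covering-or-many : NoInfiniteClasses 𝒮 → ∀ m →
    (∃ λ n → Σ (AtLeastClasses 𝒮 (FiniteClass 𝒮) n) λ G → Covering (proj₁ G)) ⊎
    AtLeastClasses 𝒮 (FiniteClass 𝒮) m
  covering-or-many none zero = inj₂ ((λ ()) , (λ ()) , (λ ()))
  covering-or-many none (suc m) with covering-or-many none m
  ... | inj₁ covering = inj₁ covering
  ... | inj₂ G with covering⊎more none G
  ...   | inj₁ cover = inj₁ (_ , G , cover)
  ...   | inj₂ more = inj₂ more

  -- Every class is R-related to one of finitely many, so its size is one of theirs.
  classSizes-bounded : FinitelyManyFiniteClasses 𝒮 → NoInfiniteClasses 𝒮 →
    ∃ λ K → ∀ x k → ClassSize 𝒮 k x → k ≤ K
  classSizes-bounded (m , ¬many) none with covering-or-many none (suc m)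
  ... | inj₂ many = ⊥-elim (¬many many)
  ... | inj₁ (n , (g , g-finite , _) , cover) = sumᵛ sizes , bounded
    where
    sizes : Vector ℕ n
    sizes i = proj₁ (g-finite i)
    bounded : ∀ x k → ClassSize 𝒮 k x → k ≤ sumᵛ sizes
    bounded x k size with i , xRgi ← cover x
      with refl ← ClassSize-unique (ClassSize-respR xRgi size) (proj₂ (g-finite i)) = ≤-sumᵛ sizes i

asStr-isEqStr : (𝒜 : EqStruct) → IsEqStr (asStr 𝒜)
asStr-isEqStr 𝒜 = record
  { ≈-refl = refl ; ≈-sym = sym ; ≈-trans = trans
  ; R-refl = λ {x} → E-refl (proj₂ x) ; R-sym = E-sym ; R-trans = E-trans
  ; ≈⇒R = λ {x} x≈y → subst (E (proj₁ x)) x≈y (E-refl (proj₂ x)) }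
  where open EqStruct 𝒜

power-isEqStr : (𝒜 : EqStruct) (C : ℕ → Set) → IsEqStr (CohesivePower 𝒜 C)
power-isEqStr 𝒜 C = record
  { ≈-refl = λ {ψ} → ≈ᶜ-refl (proj₂ ψ) ; ≈-sym = ≈ᶜ-sym ; ≈-trans = ≈ᶜ-trans
  ; R-refl = λ {ψ} → Eᶜ-refl (proj₂ ψ) ; R-sym = Eᶜ-sym ; R-trans = Eᶜ-trans
  ; ≈⇒R = λ {ψ} → ≈ᶜ⇒Eᶜ (proj₂ ψ) }
  where open PowerLaws 𝒜 C

asStr-enumerable : ExcludedMiddle 0ℓ → (𝒜 : EqStruct) → Enumerable (asStr 𝒜)
asStr-enumerable em 𝒜 = injection⇒enumerable em (asStr 𝒜) proj₁ (λ _ _ same → same)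

power-enumerable : ExcludedMiddle 0ℓ → (𝒜 : EqStruct) (C : ℕ → Set) → Enumerable (CohesivePower 𝒜 C)
power-enumerable em 𝒜 C = injection⇒enumerable em (CohesivePower 𝒜 C) (λ ψ → code (proj₁ ψ))
  λ ψ φ same → subst (proj₁ ψ ≈ᶜ_) (code-injective (proj₁ ψ) (proj₁ φ) same) (≈ᶜ-refl (proj₂ ψ))
  where open PowerLaws 𝒜 C

power-noInfiniteClasses : (em : ExcludedMiddle 0ℓ) (𝒜 : EqStruct) → ComputableRel (EqStruct.E 𝒜) →
  (C : ℕ → Set) → Cohesive C → (∃ λ K → ∀ x k → ClassSize (asStr 𝒜) k x → k ≤ K) →
  NoInfiniteClasses (asStr 𝒜) → NoInfiniteClasses (CohesivePower 𝒜 C)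
power-noInfiniteClasses em 𝒜 E-computable C C-cohesive (K , bounded) none ψ ψ-infinite =
  too-many (proj₂ (⊆*-witness em (proj₁ C-cohesive) (snapshot-ae ψ g gEψ g-sep)))
  where
  open ComputablePower em 𝒜 E-computable C C-cohesive
  open ClassTheory em 𝒜′ (asStr-isEqStr 𝒜)
  g = proj₁ (ψ-infinite (suc K))
  gEψ = proj₁ (proj₂ (ψ-infinite (suc K)))
  g-sep = proj₂ (proj₂ (ψ-infinite (suc K)))
  too-many : ∀ {i} → C i × Snapshot (proj₁ ψ) (λ j → proj₁ (g j)) i → ⊥
  too-many {i} (_ , s) = finite-class (FiniteClass⊎InfiniteClass centreᴬ)
    where
    open Snapshot s
    centreᴬ : Σ ℕ (EqStruct.Dom 𝒜)
    centreᴬ = centre , proj₁ (proj₂ ψ) i centre eval-centre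
    finite-class : FiniteClass 𝒜′ centreᴬ ⊎ InfiniteClass 𝒜′ centreᴬ → ⊥
    finite-class (inj₁ (k , size)) = 1+n≰n (≤-trans
      (separated-members≤size {x = centreᴬ} {g = membersᴬ} members-E members-separated size)
      (bounded centreᴬ k size))
    finite-class (inj₂ centre-infinite) = none centreᴬ centre-infinite

mainTheorem3 : ExcludedMiddle 0ℓ →
    (𝒜 : EqStruct) → ComputableEqStruct 𝒜 →
    (C : ℕ → Set) → Cohesive C →
    let 𝒜' = asStr 𝒜
        ℬ = CohesivePower 𝒜 C
    in (∀ k n → χ ℬ k n ⇔ χ 𝒜' k n)
       × (InfinitelyManyInfiniteClasses 𝒜' → InfinitelyManyInfiniteClasses ℬ)
       × (∀ n → ExactlyInfiniteClasses 𝒜' n → AtLeastClasses ℬ (InfiniteClass ℬ) n)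
       × (InfinitelyManyInfiniteClasses 𝒜' → ℬ ≅ 𝒜')
       × (FinitelyManyFiniteClasses 𝒜' → NoInfiniteClasses 𝒜' → ℬ ≅ 𝒜')
mainTheorem3 em 𝒜 (_ , E-computable) C C-cohesive =
  χᴮ⇔χᴬ , (λ many n → infinite-classes (many n)) , (λ n exactly → infinite-classes (proj₁ exactly)) ,
  (λ many → ℬ≅𝒜′ λ n → (λ _ → many n) , (λ _ → infinite-classes (many n))) ,
  (λ few none → ℬ≅𝒜′ (AtLeastClasses-none {ℬ} {𝒜′}
    (power-noInfiniteClasses em 𝒜 E-computable C C-cohesive
      (FiniteClasses.classSizes-bounded em 𝒜′ (asStr-isEqStr 𝒜) few none) none) none))
  where
  open ComputablePower em 𝒜 E-computable C C-cohesive
  infinite-classes : ∀ {n} → AtLeastClasses 𝒜′ (InfiniteClass 𝒜′) n → AtLeastClasses ℬ (InfiniteClass ℬ) n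
  infinite-classes = const-atLeastClasses {InfiniteClass 𝒜′} {InfiniteClass ℬ} const-infinite
  ℬ≅𝒜′ : (∀ n → AtLeastClasses ℬ (InfiniteClass ℬ) n ⇔ AtLeastClasses 𝒜′ (InfiniteClass 𝒜′) n) → ℬ ≅ 𝒜′
  ℬ≅𝒜′ = ≅-from-invariants em (power-isEqStr 𝒜 C) (asStr-isEqStr 𝒜)
    (power-enumerable em 𝒜 C) (asStr-enumerable em 𝒜) χᴮ⇔χᴬ
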